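{- Let $n,d,l,s$ be positive integers with $d(n-1)=ls$, and let $P=\{1,\dots,n\}$. Suppose that for each $i\in P$ there is a tactical configuration $(P\setminus\{i\},\mathcal{B}_i)$ with parameters $(n-1,s,l,d)$. Let $D_1$ be the directed graph with vertex set $V=\{(g,B): g\in P,\ B\in\mathcal{B}_g\}$ and an arc $(g,B)\to(g',B')$ if and only if $g\in B'$. Then $D_1$ is a directed strongly regular graph with parameters \[(v,k,t,\lambda,\mu)=\big(ns,\ ls,\ ld,\ (l-1)d,\ ld\big).\]
   Context: A tactical configuration with parameters $(\bar v,\bar b,\bar k,\bar r)$ is a pair $(X,\mathcal{B})$ where $X$ is a set of $\bar v$ points and $\mathcal{B}$ is a collection of $\bar b$ subsets of $X$ (blocks), each of size $\bar k$, such that every point lies in exactly $\bar r$ blocks. A directed strongly regular graph with parameters $(v,k,t,\lambda,\mu)$ is a loopless directed graph on $v$ vertices with adjacency matrix $A$ satisfying $AJ=JA=kJ$ and $A^2=tI+\lambda A+\mu(J-I-A)$, where $I$ is the identity and $J$ the all-ones matrix. -}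

module Defs where

open import Data.Bool using (Bool; true; false; if_then_else_)
open import Data.Nat using (ℕ; zero; suc)
open import Data.Integer using (ℤ; +_; _+_; _-_; _*_)
open import Data.Fin using (Fin; zero; suc; _≟_; remQuot)
open import Data.Fin.Subset using (Subset; _∈_; _⊆_; ∣_∣; ⊤; _─_; ⁅_⁆)
open import Data.Vec using (lookup; tabulate)
open import Data.Product using (_×_; _,_)
open import Relation.Nullary using (does)
open import Relation.Binary.PropositionalEquality using (_≡_)

-- A tactical configuration (X, B) with parameters (v̄, b̄, k̄, r̄), where
-- X ⊆ Fin n is the point set and the b̄ blocks are given as an indexed
-- family B : Fin b̄ → Subset n (a "collection", repetitions allowed).
blocksThrough : ∀ {n b} → (Fin b → Subset n) → Fin n → Subset b
blocksThrough B x = tabulate (λ j → lookup (B j) x)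

IsTactical : ∀ {n} (v̄ b̄ k̄ r̄ : ℕ) → Subset n → (Fin b̄ → Subset n) → Set
IsTactical v̄ b̄ k̄ r̄ X B =
  (∣ X ∣ ≡ v̄) ×
  (∀ j → B j ⊆ X) ×
  (∀ j → ∣ B j ∣ ≡ k̄) ×
  (∀ x → x ∈ X → ∣ blocksThrough B x ∣ ≡ r̄)

P∖ : ∀ {n} → Fin n → Subset n
P∖ i = ⊤ ─ ⁅ i ⁆

Matrix : ℕ → Set
Matrix v = Fin v → Fin v → ℤ

sumFin : ∀ m → (Fin m → ℤ) → ℤ
sumFin zero    f = + 0
sumFin (suc m) f = f zero + sumFin m (λ i → f (suc i))

_⊗_ : ∀ {v} → Matrix v → Matrix v → Matrix v
_⊗_ {v} A B x y = sumFin v (λ z → A x z * B z y)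

Iₘ : ∀ {v} → Matrix v
Iₘ x y = if does (x ≟ y) then + 1 else + 0

Jₘ : ∀ {v} → Matrix v
Jₘ x y = + 1

adjMatrix : ∀ {v} → (Fin v → Fin v → Bool) → Matrix v
adjMatrix E x y = if E x y then + 1 else + 0

IsDSRG : (v k t lam mu : ℕ) → (Fin v → Fin v → Bool) → Set
IsDSRG v k t lam mu E =
  (∀ x → E x x ≡ false) ×
  (∀ x y → (A ⊗ J) x y ≡ + k * J x y) ×
  (∀ x y → (J ⊗ A) x y ≡ + k * J x y) ×
  (∀ x y → (A ⊗ A) x y ≡
       + t * Iₘ x y + + lam * A x y + + mu * (J x y - Iₘ x y - A x y))
  where
  A : Matrix v
  A = adjMatrix E
  J : Matrix v
  J = Jₘ

-- The digraph D₁.  Vertex (g , B) with g ∈ P and B = Bs g b is encoded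
-- by the pair (g , b) ∈ Fin n × Fin s, enumerated as Fin (n * s) via
-- remQuot.  Arc (g,B) → (g',B') iff g ∈ B'.
D₁ : ∀ {n s} → (Fin n → Fin s → Subset n) → Fin (n Data.Nat.* s) → Fin (n Data.Nat.* s) → Bool
D₁ {n} {s} Bs p q with remQuot {n} s p | remQuot {n} s q
... | g , b | g' , b' = lookup (Bs g' b') g

module Submission where

-- Write a vertex of D₁ in block coordinates (g , b), standing for the
-- block B_{g,b} of the configuration on P ∖ {g}; the arc (g,b) → (h,c)
-- exists iff g ∈ B_{h,c}.  Every entry of A J, J A and A² is a double
-- sum over the out- or in-neighbours (h , c), and the inner sum over c
-- is a count in a single tactical configuration:
--   * the blocks of B_h through g number d·[g ≠ h]          (A J, A²),
--   * each block B_{g',b'} has l points                      (J A, A²),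
-- so the row sums are d(n-1) = ls, the column sums are s·l, and the
-- number of 2-paths (g,b) → (g',b') is d·#(B_{g',b'} ∖ {g}) = d(l - a)
-- with a the (g,b)(g',b') entry of A.  The DSRG equation with
-- (t, λ, μ) = (ld, (l-1)d, ld) is then a ring identity in a and the
-- identity entry.

open import Defs
open import Data.Nat using (ℕ; _*_; _∸_; _≤_)
open import Data.Fin using (Fin)
open import Data.Fin.Subset using (Subset)
open import Relation.Binary.PropositionalEquality using (_≡_)

open import Data.Nat as ℕ using (zero; suc)
import Data.Nat.Properties as ℕP
open import Data.Bool using (Bool; true; false; if_then_else_)
open import Data.Fin using (zero; suc; _↑ˡ_; _↑ʳ_; combine; remQuot)
open import Data.Fin.Properties using (remQuot-combine; combine-remQuot)
open import Data.Fin.Subset using (⊤; ⊥; _─_; ∣_∣)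
open import Data.Fin.Subset.Properties using (p─⊥≡p)
open import Data.Vec using ([]; _∷_; lookup)
open import Data.Vec.Properties using (lookup-replicate; lookup∘tabulate; []=⇒lookup; lookup⇒[]=)
open import Data.Integer as ℤ using (ℤ; +_)
import Data.Integer.Properties as ℤP
open import Data.Integer.Tactic.RingSolver using (solve-∀)
open import Algebra.Properties.Semiring.Sum ℤP.+-*-semiring using (sum-syntax; sum-cong-≗; ∑-distrib-+; *-distribˡ-sum; *-distribʳ-sum; sum-replicate-zero)
open import Data.Product using (_,_; proj₁; proj₂)
open import Function using (_∘_)
open import Relation.Nullary using (contradiction)
open import Relation.Binary.PropositionalEquality using (refl; sym; trans; cong; cong₂; subst; module ≡-Reasoning)
open ≡-Reasoning

sumFin≡∑ : ∀ m (f : Fin m → ℤ) → sumFin m f ≡ ∑[ i < m ] f i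
sumFin≡∑ zero    f = refl
sumFin≡∑ (suc m) f = cong (ℤ._+_ (f zero)) (sumFin≡∑ m (f ∘ suc))

∑-const : ∀ m (x : ℤ) → ∑[ i < m ] x ≡ + m ℤ.* x
∑-const zero    x = refl
∑-const (suc m) x = trans (cong (ℤ._+_ x) (∑-const m x)) (sym (ℤP.suc-* (+ m) x))

∑-δ : ∀ m (g : Fin m) (f : Fin m → ℤ) → ∑[ h < m ] (Iₘ h g ℤ.* f h) ≡ f g
∑-δ (suc m) zero    f = trans (cong₂ ℤ._+_ (ℤP.*-identityˡ (f zero)) (sum-replicate-zero m))
                              (ℤP.+-identityʳ (f zero))
∑-δ (suc m) (suc g) f = trans (ℤP.+-identityˡ _) (∑-δ m g (f ∘ suc))

∑-split : ∀ a b (f : Fin (a ℕ.+ b) → ℤ) →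
  ∑[ z < a ℕ.+ b ] f z ≡ ∑[ i < a ] f (i ↑ˡ b) ℤ.+ ∑[ j < b ] f (a ↑ʳ j)
∑-split zero    b f = sym (ℤP.+-identityˡ _)
∑-split (suc a) b f = trans (cong (ℤ._+_ (f zero)) (∑-split a b (f ∘ suc)))
  (sym (ℤP.+-assoc (f zero) (∑[ i < a ] f (suc (i ↑ˡ b))) (∑[ j < b ] f (suc a ↑ʳ j))))

∑-blocks : ∀ n s (f : Fin (n * s) → ℤ) →
  ∑[ z < n * s ] f z ≡ ∑[ g < n ] ∑[ c < s ] f (combine g c)
∑-blocks zero    s f = refl
∑-blocks (suc n) s f = trans (∑-split s (n * s) f)
  (cong (ℤ._+_ (∑[ c < s ] f (c ↑ˡ n * s))) (∑-blocks n s (f ∘ (s ↑ʳ_))))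

by-coordinates : ∀ {n s ℓ} {P : Fin (n * s) → Set ℓ} →
  (∀ g b → P (combine g b)) → ∀ x → P x
by-coordinates {n} {s} {P = P} p x =
  subst P (combine-remQuot {n} s x) (p (proj₁ (remQuot {n} s x)) (proj₂ (remQuot {n} s x)))

⟦_⟧ : Bool → ℤ
⟦ b ⟧ = if b then + 1 else + 0

∣∣≡∑ : ∀ {m} (p : Subset m) → + ∣ p ∣ ≡ ∑[ i < m ] ⟦ lookup p i ⟧
∣∣≡∑ []          = refl
∣∣≡∑ (true  ∷ p) = trans (ℤP.pos-+ 1 ∣ p ∣) (cong (ℤ._+_ (+ 1)) (∣∣≡∑ p))
∣∣≡∑ (false ∷ p) = trans (∣∣≡∑ p) (sym (ℤP.+-identityˡ _))

-- Away from the removed point, P ∖ {i} is ⊤ ─ ⊥, the full set.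
⊤─⊥-full : ∀ {m} (x : Fin m) → lookup (⊤ ─ ⊥) x ≡ true
⊤─⊥-full x = trans (cong (λ p → lookup p x) (p─⊥≡p ⊤)) (lookup-replicate x true)

P∖-excludes : ∀ {m} (i : Fin m) → lookup (P∖ i) i ≡ false
P∖-excludes zero    = refl
P∖-excludes (suc i) = P∖-excludes i

P∖-sym : ∀ {m} (i x : Fin m) → lookup (P∖ i) x ≡ lookup (P∖ x) i
P∖-sym zero    zero    = refl
P∖-sym zero    (suc x) = ⊤─⊥-full x
P∖-sym (suc i) zero    = sym (⊤─⊥-full i)
P∖-sym (suc i) (suc x) = P∖-sym i x

P∖-complement : ∀ {m} (i x : Fin m) → ⟦ lookup (P∖ i) x ⟧ ℤ.+ Iₘ x i ≡ + 1
P∖-complement zero    zero    = refl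
P∖-complement zero    (suc x) = cong (λ b → ⟦ b ⟧ ℤ.+ + 0) (⊤─⊥-full x)
P∖-complement (suc i) zero    = refl
P∖-complement (suc i) (suc x) = P∖-complement i x

∑-P∖ : ∀ m (g : Fin m) (f : Fin m → ℤ) →
  ∑[ h < m ] (⟦ lookup (P∖ g) h ⟧ ℤ.* f h) ℤ.+ f g ≡ ∑[ h < m ] f h
∑-P∖ m g f = begin
  ∑[ h < m ] (⟦ lookup (P∖ g) h ⟧ ℤ.* f h) ℤ.+ f g
    ≡⟨ cong (ℤ._+_ (∑[ h < m ] (⟦ lookup (P∖ g) h ⟧ ℤ.* f h))) (sym (∑-δ m g f)) ⟩
  ∑[ h < m ] (⟦ lookup (P∖ g) h ⟧ ℤ.* f h) ℤ.+ ∑[ h < m ] (Iₘ h g ℤ.* f h)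
    ≡⟨ sym (∑-distrib-+ (λ h → ⟦ lookup (P∖ g) h ⟧ ℤ.* f h) (λ h → Iₘ h g ℤ.* f h)) ⟩
  ∑[ h < m ] (⟦ lookup (P∖ g) h ⟧ ℤ.* f h ℤ.+ Iₘ h g ℤ.* f h)
    ≡⟨ sum-cong-≗ weights-add-to-one ⟩
  ∑[ h < m ] f h ∎
  where
  weights-add-to-one : ∀ h → ⟦ lookup (P∖ g) h ⟧ ℤ.* f h ℤ.+ Iₘ h g ℤ.* f h ≡ f h
  weights-add-to-one h = begin
    ⟦ lookup (P∖ g) h ⟧ ℤ.* f h ℤ.+ Iₘ h g ℤ.* f h ≡⟨ sym (ℤP.*-distribʳ-+ (f h) ⟦ lookup (P∖ g) h ⟧ (Iₘ h g)) ⟩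
    (⟦ lookup (P∖ g) h ⟧ ℤ.+ Iₘ h g) ℤ.* f h       ≡⟨ cong (ℤ._* f h) (P∖-complement g h) ⟩
    + 1 ℤ.* f h                                      ≡⟨ ℤP.*-identityˡ (f h) ⟩
    f h ∎

module Tactical {n v̄ b̄ k̄ r̄ : ℕ} {X : Subset n} {B : Fin b̄ → Subset n}
                (tactical : IsTactical v̄ b̄ k̄ r̄ X B) where

  point-count : ∑[ x < n ] ⟦ lookup X x ⟧ ≡ + v̄
  point-count = trans (sym (∣∣≡∑ X)) (cong +_ (proj₁ tactical))

  block-size : ∀ j → ∑[ x < n ] ⟦ lookup (B j) x ⟧ ≡ + k̄
  block-size j = trans (sym (∣∣≡∑ (B j))) (cong +_ (proj₁ (proj₂ (proj₂ tactical)) j))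

  outside : ∀ {x} → lookup X x ≡ false → ∀ j → lookup (B j) x ≡ false
  outside {x} x∉X j with lookup (B j) x in x∈Bj
  ... | false = refl
  ... | true  = contradiction (trans (sym x∈X) x∉X) (λ ())
    where
    x∈X : lookup X x ≡ true
    x∈X = []=⇒lookup (proj₁ (proj₂ tactical) j (lookup⇒[]= x (B j) x∈Bj))

  degree : ∀ x → ∑[ j < b̄ ] ⟦ lookup (B j) x ⟧ ≡ + r̄ ℤ.* ⟦ lookup X x ⟧
  degree x with lookup X x in x∈X?
  ... | true  = begin
    ∑[ j < b̄ ] ⟦ lookup (B j) x ⟧
      ≡⟨ sum-cong-≗ (λ j → cong ⟦_⟧ (sym (lookup∘tabulate (λ j → lookup (B j) x) j))) ⟩
    ∑[ j < b̄ ] ⟦ lookup (blocksThrough B x) j ⟧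
      ≡⟨ sym (∣∣≡∑ (blocksThrough B x)) ⟩
    + ∣ blocksThrough B x ∣
      ≡⟨ cong +_ (proj₂ (proj₂ (proj₂ tactical)) x (lookup⇒[]= x X x∈X?)) ⟩
    + r̄
      ≡⟨ sym (ℤP.*-identityʳ (+ r̄)) ⟩
    + r̄ ℤ.* + 1 ∎
  ... | false = begin
    ∑[ j < b̄ ] ⟦ lookup (B j) x ⟧ ≡⟨ sum-cong-≗ (cong ⟦_⟧ ∘ outside x∈X?) ⟩
    ∑[ j < b̄ ] (+ 0)             ≡⟨ sum-replicate-zero b̄ ⟩
    + 0                           ≡⟨ sym (ℤP.*-zeroʳ (+ r̄)) ⟩
    + r̄ ℤ.* + 0 ∎

module D₁-counts (n d l s : ℕ) (Bs : Fin n → Fin s → Subset n)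
                 (counting : d * (n ∸ 1) ≡ l * s)
                 (tactical : ∀ i → IsTactical (n ∸ 1) s l d (P∖ i) (Bs i)) where

  A : Matrix (n * s)
  A = adjMatrix (D₁ Bs)

  D₁-blocks : ∀ g b h c → D₁ Bs (combine g b) (combine h c) ≡ lookup (Bs h c) g
  D₁-blocks g b h c = cong₂ (λ x y → lookup (Bs (proj₁ y) (proj₂ y)) (proj₁ x))
    (remQuot-combine {n} {s} g b) (remQuot-combine {n} {s} h c)

  A-blocks : ∀ g b h c → A (combine g b) (combine h c) ≡ ⟦ lookup (Bs h c) g ⟧
  A-blocks g b h c = cong ⟦_⟧ (D₁-blocks g b h c)

  -- The blocks B_{g,b} avoid g, so D₁ has no loops.
  loopless : ∀ x → D₁ Bs x x ≡ false
  loopless = by-coordinates λ g b →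
    trans (D₁-blocks g b g b) (Tactical.outside (tactical g) (P∖-excludes g) b)

  fibre-degree : ∀ g h → ∑[ c < s ] ⟦ lookup (Bs h c) g ⟧ ≡ + d ℤ.* ⟦ lookup (P∖ g) h ⟧
  fibre-degree g h = trans (Tactical.degree (tactical h) g) (cong (λ b → + d ℤ.* ⟦ b ⟧) (P∖-sym h g))

  row-sum : ∀ x → ∑[ z < n * s ] A x z ≡ + (l * s)
  row-sum = by-coordinates λ g b → begin
    ∑[ z < n * s ] A (combine g b) z
      ≡⟨ ∑-blocks n s (A (combine g b)) ⟩
    ∑[ h < n ] ∑[ c < s ] A (combine g b) (combine h c)
      ≡⟨ sum-cong-≗ (λ h → trans (sum-cong-≗ (A-blocks g b h)) (fibre-degree g h)) ⟩
    ∑[ h < n ] (+ d ℤ.* ⟦ lookup (P∖ g) h ⟧)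
      ≡⟨ sym (*-distribˡ-sum (+ d) (λ h → ⟦ lookup (P∖ g) h ⟧)) ⟩
    + d ℤ.* ∑[ h < n ] ⟦ lookup (P∖ g) h ⟧
      ≡⟨ cong (ℤ._*_ (+ d)) (Tactical.point-count (tactical g)) ⟩
    + d ℤ.* + (n ∸ 1)
      ≡⟨ sym (ℤP.pos-* d (n ∸ 1)) ⟩
    + (d * (n ∸ 1))
      ≡⟨ cong +_ counting ⟩
    + (l * s) ∎

  -- In-degree: the in-neighbours of (g' , b') are the s vertices of each
  -- fibre over a point of B_{g',b'}.
  column-sum : ∀ y → ∑[ z < n * s ] A z y ≡ + (l * s)
  column-sum = by-coordinates λ g' b' → begin
    ∑[ z < n * s ] A z (combine g' b')
      ≡⟨ ∑-blocks n s (λ z → A z (combine g' b')) ⟩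
    ∑[ h < n ] ∑[ c < s ] A (combine h c) (combine g' b')
      ≡⟨ sum-cong-≗ (λ h → trans (sum-cong-≗ (λ c → A-blocks h c g' b'))
                                 (∑-const s ⟦ lookup (Bs g' b') h ⟧)) ⟩
    ∑[ h < n ] (+ s ℤ.* ⟦ lookup (Bs g' b') h ⟧)
      ≡⟨ sym (*-distribˡ-sum (+ s) (λ h → ⟦ lookup (Bs g' b') h ⟧)) ⟩
    + s ℤ.* ∑[ h < n ] ⟦ lookup (Bs g' b') h ⟧
      ≡⟨ cong (ℤ._*_ (+ s)) (Tactical.block-size (tactical g') b') ⟩
    + s ℤ.* + l
      ≡⟨ sym (ℤP.pos-* s l) ⟩
    + (s * l)
      ≡⟨ cong +_ (ℕP.*-comm s l) ⟩
    + (l * s) ∎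

  A⊗J : ∀ x y → (A ⊗ Jₘ) x y ≡ + (l * s) ℤ.* Jₘ x y
  A⊗J x y = begin
    (A ⊗ Jₘ) x y                     ≡⟨ sumFin≡∑ (n * s) (λ z → A x z ℤ.* + 1) ⟩
    ∑[ z < n * s ] (A x z ℤ.* + 1)   ≡⟨ sum-cong-≗ (ℤP.*-identityʳ ∘ A x) ⟩
    ∑[ z < n * s ] A x z             ≡⟨ row-sum x ⟩
    + (l * s)                        ≡⟨ sym (ℤP.*-identityʳ (+ (l * s))) ⟩
    + (l * s) ℤ.* + 1 ∎

  J⊗A : ∀ x y → (Jₘ ⊗ A) x y ≡ + (l * s) ℤ.* Jₘ x y
  J⊗A x y = begin
    (Jₘ ⊗ A) x y                     ≡⟨ sumFin≡∑ (n * s) (λ z → + 1 ℤ.* A z y) ⟩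
    ∑[ z < n * s ] (+ 1 ℤ.* A z y)   ≡⟨ sum-cong-≗ (λ z → ℤP.*-identityˡ (A z y)) ⟩
    ∑[ z < n * s ] A z y             ≡⟨ column-sum y ⟩
    + (l * s)                        ≡⟨ sym (ℤP.*-identityʳ (+ (l * s))) ⟩
    + (l * s) ℤ.* + 1 ∎

  -- The 2-paths (g , b) → (h , c) → (g' , b') are indexed by a point
  -- h ∈ B_{g',b'} ∖ {g} and one of the d blocks of B_h through g.
  two-paths : ∀ x y → (A ⊗ A) x y ≡ + d ℤ.* (+ l ℤ.- A x y)
  two-paths = by-coordinates λ g b → by-coordinates λ g' b' → let
      x = combine g b
      y = combine g' b'
      inB' : Fin n → ℤ
      inB' h = ⟦ lookup (Bs g' b') h ⟧
      S : ℤ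
      S = ∑[ h < n ] (⟦ lookup (P∖ g) h ⟧ ℤ.* inB' h)
      S+a≡l : S ℤ.+ A x y ≡ + l
      S+a≡l = trans (cong (ℤ._+_ S) (A-blocks g b g' b'))
                    (trans (∑-P∖ n g inB') (Tactical.block-size (tactical g') b'))
    in begin
    (A ⊗ A) x y
      ≡⟨ sumFin≡∑ (n * s) (λ z → A x z ℤ.* A z y) ⟩
    ∑[ z < n * s ] (A x z ℤ.* A z y)
      ≡⟨ ∑-blocks n s (λ z → A x z ℤ.* A z y) ⟩
    ∑[ h < n ] ∑[ c < s ] (A x (combine h c) ℤ.* A (combine h c) y)
      ≡⟨ sum-cong-≗ (λ h → sum-cong-≗ (λ c → cong₂ ℤ._*_ (A-blocks g b h c) (A-blocks h c g' b'))) ⟩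
    ∑[ h < n ] ∑[ c < s ] (⟦ lookup (Bs h c) g ⟧ ℤ.* inB' h)
      ≡⟨ sum-cong-≗ (λ h → sym (*-distribʳ-sum (inB' h) (λ c → ⟦ lookup (Bs h c) g ⟧))) ⟩
    ∑[ h < n ] (∑[ c < s ] ⟦ lookup (Bs h c) g ⟧ ℤ.* inB' h)
      ≡⟨ sum-cong-≗ (λ h → trans (cong (ℤ._* inB' h) (fibre-degree g h))
                                 (ℤP.*-assoc (+ d) ⟦ lookup (P∖ g) h ⟧ (inB' h))) ⟩
    ∑[ h < n ] (+ d ℤ.* (⟦ lookup (P∖ g) h ⟧ ℤ.* inB' h))
      ≡⟨ sym (*-distribˡ-sum (+ d) (λ h → ⟦ lookup (P∖ g) h ⟧ ℤ.* inB' h)) ⟩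
    + d ℤ.* S
      ≡⟨ cong (ℤ._*_ (+ d)) (trans (add-sub S (A x y)) (cong (ℤ._- A x y) S+a≡l)) ⟩
    + d ℤ.* (+ l ℤ.- A x y) ∎
    where
    add-sub : ∀ (S a : ℤ) → S ≡ (S ℤ.+ a) ℤ.- a
    add-sub = solve-∀

-- At an entry with adjacency a and identity entry i, the DSRG equation
-- with (t, λ, μ) = (ld, (l-1)d, ld) says that there are d (l - a) 2-paths.
dsrg-identity : ∀ l d (a i : ℤ) → 1 ≤ l →
  + d ℤ.* (+ l ℤ.- a) ≡
    + (l * d) ℤ.* i ℤ.+ + ((l ∸ 1) * d) ℤ.* a ℤ.+ + (l * d) ℤ.* (+ 1 ℤ.- i ℤ.- a)
dsrg-identity (suc l') d a i _ = identity (ℤP.pos-* (suc l') d) (ℤP.pos-* l' d)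
  where
  ring : ∀ L D a i → D ℤ.* (+ 1 ℤ.+ L ℤ.- a) ≡
    (+ 1 ℤ.+ L) ℤ.* D ℤ.* i ℤ.+ L ℤ.* D ℤ.* a ℤ.+ (+ 1 ℤ.+ L) ℤ.* D ℤ.* (+ 1 ℤ.- i ℤ.- a)
  ring = solve-∀
  identity : ∀ {ld l'd} → ld ≡ + suc l' ℤ.* + d → l'd ≡ + l' ℤ.* + d →
    + d ℤ.* (+ suc l' ℤ.- a) ≡ ld ℤ.* i ℤ.+ l'd ℤ.* a ℤ.+ ld ℤ.* (+ 1 ℤ.- i ℤ.- a)
  identity refl refl = ring (+ l') (+ d) a i

mainTheorem6 : (n d l s : ℕ) → 1 ≤ n → 1 ≤ d → 1 ≤ l → 1 ≤ s →
    d * (n ∸ 1) ≡ l * s →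
    (Bs : Fin n → Fin s → Subset n) →
    (∀ i → IsTactical (n ∸ 1) s l d (P∖ i) (Bs i)) →
    IsDSRG (n * s) (l * s) (l * d) ((l ∸ 1) * d) (l * d) (D₁ Bs)
mainTheorem6 n d l s _ _ 1≤l _ counting Bs tactical =
  loopless , A⊗J , J⊗A ,
  λ x y → trans (two-paths x y) (dsrg-identity l d (A x y) (Iₘ x y) 1≤l)
  where open D₁-counts n d l s Bs counting tactical
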